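{- Every context tree over $A$ that has perfect memory is complete.
   Context: Fix a finite alphabet $A=\{a_1,\dots,a_n\}$. A string is a finite sequence of letters of $A$ (possibly empty); $\overline{uv}$ denotes concatenation. A string $v$ is a postfix of $s$, written $v\prec s$, if $s=\overline{wv}$ for some string $w$. A context tree over $A$ is a finite rooted tree in which every non-root vertex is labeled by a letter of $A$, with no two siblings carrying the same label. A context is the string read along the path from a leaf to the root (leaf's label first, label of the root's child last); $\mathcal{T}^*$ is the set of contexts of $\mathcal{T}$. $\mathcal{T}$ is complete if every node is either a leaf or has exactly $n$ children. $\mathcal{T}$ has perfect memory if for every $c\in\mathcal{T}^*$ and every $i\in\{1,\dots,n\}$ there exists $u\in\mathcal{T}^*$ with $u\prec\overline{ca_i}$. -}

module Defs where

open import Data.Nat using (ℕ)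
open import Data.Fin using (Fin)
open import Data.List using (List; []; _∷_; _++_; map; length; reverse; [_])
open import Data.List.Membership.Propositional using (_∈_)
open import Data.List.Relation.Unary.All using (All)
open import Data.List.Relation.Unary.Unique.Propositional using (Unique)
open import Data.Product using (_×_; _,_; proj₁; proj₂; ∃)
open import Data.Sum using (_⊎_)
open import Relation.Binary.PropositionalEquality using (_≡_)

Str : ℕ → Set
Str n = List (Fin n)

_≺_ : ∀ {n} → Str n → Str n → Set
v ≺ s = ∃ λ w → s ≡ w ++ v

-- A (finite, rooted) tree whose non-root vertices carry letters:
-- a node is given by its list of children, each with its label.
data Tree (n : ℕ) : Set where
  node : List (Fin n × Tree n) → Tree n

data IsContextTree {n : ℕ} : Tree n → Set where
  node : ∀ {cs} → Unique (map proj₁ cs) →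
         All (λ p → IsContextTree (proj₂ p)) cs → IsContextTree (node cs)

-- RootPath t p : p is the sequence of labels on a path from the root of t
-- down to a leaf (label of the root's child first, leaf's label last).
data RootPath {n : ℕ} : Tree n → Str n → Set where
  leaf : RootPath (node []) []
  step : ∀ {cs a t p} → (a , t) ∈ cs → RootPath t p → RootPath (node cs) (a ∷ p)

-- c ∈ T* : c is a context of T (read from leaf to root).
IsContext : ∀ {n} → Tree n → Str n → Set
IsContext t c = RootPath t (reverse c)

data Complete {n : ℕ} : Tree n → Set where
  node : ∀ {cs} → (cs ≡ [] ⊎ length cs ≡ n) →
         All (λ p → Complete (proj₂ p)) cs → Complete (node cs)

PerfectMemory : ∀ {n} → Tree n → Set
PerfectMemory {n} t = ∀ (c : Str n) → IsContext t c → ∀ (a : Fin n) →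
  ∃ λ u → IsContext t u × (u ≺ (c ++ [ a ]))

-- Read contexts root-first. Perfect memory then says: for every root-to-leaf
-- path r and letter a, some root-to-leaf path is a prefix of a r. By induction
-- on a word w this shows that every w either is a path from the root or extends
-- a root-to-leaf path. Apply it to p b, where p leads to an internal node: p b
-- cannot extend a leaf path strictly inside p (leaves have no descendants), so
-- b labels a child of that node. Labels of siblings are distinct, so an internal
-- node has exactly n children.
module Submission where

open import Defs
open import Data.Nat using (ℕ)
open import Data.Fin using (Fin)
open import Data.List using (List; []; _∷_; _++_; map; length; reverse; [_])
open import Data.List.Properties
  using (length-tabulate; length-map; reverse-++; reverse-involutive; ++-assoc; ++-cancelˡ; ∷-injective)
open import Data.List.Membership.Propositional using (_∈_)
open import Data.List.Membership.Propositional.Properties using (∈-allFin; ∈-map⁺)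
open import Data.List.Membership.Propositional.Properties.WithK using (unique∧set⇒bag)
open import Data.List.Relation.Unary.Any using (here; there)
open import Data.List.Relation.Unary.All as All using (All; []; _∷_)
open import Data.List.Relation.Unary.AllPairs using (_∷_)
open import Data.List.Relation.Unary.Unique.Propositional using (Unique)
open import Data.List.Relation.Unary.Unique.Propositional.Properties using (allFin⁺)
open import Data.List.Relation.Binary.BagAndSetEquality using (∼bag⇒↭)
open import Data.List.Relation.Binary.Permutation.Propositional.Properties using (↭-length)
open import Data.Product using (_×_; _,_; proj₁; proj₂; ∃; ∃₂)
open import Data.Sum using (_⊎_; inj₁; inj₂)
open import Data.Empty using (⊥-elim)
open import Function using (_∘_)
open import Function.Bundles using (mk⇔)
open import Relation.Binary.PropositionalEquality
  using (_≡_; refl; sym; trans; cong; subst; module ≡-Reasoning)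

length-unique-allFin : ∀ {n} (xs : List (Fin n)) → Unique xs → (∀ b → b ∈ xs) → length xs ≡ n
length-unique-allFin {n} xs xs-unique xs-complete =
  trans (↭-length (∼bag⇒↭ (unique∧set⇒bag xs-unique (allFin⁺ n)
                                           (mk⇔ (λ _ → ∈-allFin _) (λ _ → xs-complete _)))))
        (length-tabulate (λ i → i))

module _ {A : Set} where

  _⊑_ : List A → List A → Set
  p ⊑ w = ∃ λ z → w ≡ p ++ z

  _⊏_ : List A → List A → Set
  p ⊏ w = ∃₂ λ x z → w ≡ p ++ x ∷ z

  prefixes-comparable : ∀ p r l z → p ++ r ≡ l ++ z → p ⊑ l ⊎ l ⊏ p
  prefixes-comparable []      r l       z eq = inj₁ (l , refl)
  prefixes-comparable (x ∷ p) r []      z eq = inj₂ (x , p , refl)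
  prefixes-comparable (x ∷ p) r (y ∷ l) z eq with ∷-injective eq
  ... | refl , eq′ with prefixes-comparable p r l z eq′
  ...   | inj₁ (m , refl)     = inj₁ (m , refl)
  ...   | inj₂ (x′ , m , refl) = inj₂ (x′ , m , refl)

module _ {n : ℕ} where

  data Reach : Tree n → Str n → Tree n → Set where
    rnil  : ∀ {t} → Reach t [] t
    rcons : ∀ {cs a t p s} → (a , t) ∈ cs → Reach t p s → Reach (node cs) (a ∷ p) s

  RootPath⇒Reach : ∀ {t p} → RootPath t p → Reach t p (node [])
  RootPath⇒Reach leaf       = rnil
  RootPath⇒Reach (step m r) = rcons m (RootPath⇒Reach r)

  Reach⇒RootPath : ∀ {t p} → Reach t p (node []) → RootPath t p
  Reach⇒RootPath {node []} rnil = leaf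
  Reach⇒RootPath (rcons m r)    = step m (Reach⇒RootPath r)

  Reach-++ : ∀ {t p q s u} → Reach t p s → Reach s q u → Reach t (p ++ q) u
  Reach-++ rnil        r′ = r′
  Reach-++ (rcons m r) r′ = rcons m (Reach-++ r r′)

  Reach-split : ∀ {t} p {q u} → Reach t (p ++ q) u → ∃ λ s → Reach t p s × Reach s q u
  Reach-split []      r = _ , rnil , r
  Reach-split (x ∷ p) (rcons m r) with Reach-split p r
  ... | s , r₁ , r₂ = s , rcons m r₁ , r₂

  reach-leaf : (s : Tree n) → ∃ λ r → Reach s r (node [])
  reach-leaf (node [])              = [] , rnil
  reach-leaf (node ((a , t) ∷ cs)) with reach-leaf t
  ... | r , rr = a ∷ r , rcons (here refl) rr

  unique-labels⇒≡ : ∀ {cs : List (Fin n × Tree n)} {a t₁ t₂} → Unique (map proj₁ cs) →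
                    (a , t₁) ∈ cs → (a , t₂) ∈ cs → t₁ ≡ t₂
  unique-labels⇒≡ u        (here refl) (here refl) = refl
  unique-labels⇒≡ (h ∷ u)  (here refl) (there m₂)  = ⊥-elim (All.lookup h (∈-map⁺ proj₁ m₂) refl)
  unique-labels⇒≡ (h ∷ u)  (there m₁)  (here refl) = ⊥-elim (All.lookup h (∈-map⁺ proj₁ m₁) refl)
  unique-labels⇒≡ (h ∷ u)  (there m₁)  (there m₂)  = unique-labels⇒≡ u m₁ m₂

  Reach-deterministic : ∀ {t p s₁ s₂} → IsContextTree t → Reach t p s₁ → Reach t p s₂ → s₁ ≡ s₂
  Reach-deterministic ct           rnil          rnil          = refl
  Reach-deterministic (node u all) (rcons m₁ r₁) (rcons m₂ r₂) with unique-labels⇒≡ u m₁ m₂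
  ... | refl = Reach-deterministic (All.lookup all m₁) r₁ r₂

  Reach-IsContextTree : ∀ {t p s} → IsContextTree t → Reach t p s → IsContextTree s
  Reach-IsContextTree ct           rnil        = ct
  Reach-IsContextTree (node u all) (rcons m r) = Reach-IsContextTree (All.lookup all m) r

  Reach-leaf-maximal : ∀ {t l m s} → IsContextTree t →
                       Reach t l (node []) → Reach t (l ++ m) s → s ≡ node []
  Reach-leaf-maximal {l = l} ct rl r with Reach-split l r
  ... | _ , r₁ , r₂ with Reach-deterministic ct rl r₁ | r₂
  ...   | refl | rnil = refl

  Reach-child : ∀ {t p cs b m s} → IsContextTree t →
                Reach t p (node cs) → Reach t (p ++ b ∷ m) s → b ∈ map proj₁ cs
  Reach-child {p = p} ct r r′ with Reach-split p r′
  ... | _ , r₁ , rcons c _ with Reach-deterministic ct r r₁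
  ...   | refl = ∈-map⁺ proj₁ c

  Full : Tree n → Set
  Full (node cs) = cs ≡ [] ⊎ length cs ≡ n

  mutual
    complete-if-full : ∀ t → (∀ {p s} → Reach t p s → Full s) → Complete t
    complete-if-full (node cs) full =
      node (full rnil) (all-complete-if-full cs (λ m r → full (rcons m r)))

    all-complete-if-full : ∀ cs → (∀ {a t p s} → (a , t) ∈ cs → Reach t p s → Full s) →
                           All (Complete ∘ proj₂) cs
    all-complete-if-full []             full = []
    all-complete-if-full ((a , t) ∷ cs) full =
      complete-if-full t (full (here refl)) ∷ all-complete-if-full cs (full ∘ there)

  module _ {t : Tree n} (pm : PerfectMemory t) where

    perfectMemory-rootFirst : ∀ {r} → Reach t r (node []) → ∀ a →
                              ∃ λ l → Reach t l (node []) × l ⊑ (a ∷ r)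
    perfectMemory-rootFirst {r} rr a
      with pm (reverse r) (subst (RootPath t) (sym (reverse-involutive r)) (Reach⇒RootPath rr)) a
    ... | u , ru , w , eq = reverse u , RootPath⇒Reach ru , reverse w , eq′
      where
      open ≡-Reasoning
      eq′ : a ∷ r ≡ reverse u ++ reverse w
      eq′ = begin
        a ∷ r                                  ≡⟨ cong (a ∷_) (sym (reverse-involutive r)) ⟩
        reverse [ a ] ++ reverse (reverse r)   ≡⟨ sym (reverse-++ (reverse r) [ a ]) ⟩
        reverse (reverse r ++ [ a ])           ≡⟨ cong reverse eq ⟩
        reverse (w ++ u)                       ≡⟨ reverse-++ w u ⟩
        reverse u ++ reverse w                 ∎

    path-or-extends-leaf : ∀ w → (∃ λ s → Reach t w s) ⊎ (∃ λ l → Reach t l (node []) × l ⊑ w)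
    path-or-extends-leaf []      = inj₁ (_ , rnil)
    path-or-extends-leaf (x ∷ w) with path-or-extends-leaf w
    ... | inj₁ (s , rs) with reach-leaf s
    ...   | r , rr with perfectMemory-rootFirst (Reach-++ rs rr) x
    ...     | l , rl , z , eq with prefixes-comparable (x ∷ w) r l z eq
    ...       | inj₁ (m , refl)      = inj₁ (_ , proj₁ (proj₂ (Reach-split (x ∷ w) rl)))
    ...       | inj₂ (y , m , eq′)   = inj₂ (l , rl , y ∷ m , eq′)
    path-or-extends-leaf (x ∷ w) | inj₂ (l′ , rl′ , z′ , refl) with perfectMemory-rootFirst rl′ x
    ... | l , rl , z , eq = inj₂ (l , rl , z ++ z′ , trans (cong (_++ z′) eq) (++-assoc l z z′))

  module _ {t : Tree n} (ct : IsContextTree t) (pm : PerfectMemory t) where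

    internal-node-has-all-labels : ∀ {p c cs} → Reach t p (node (c ∷ cs)) → ∀ b → b ∈ map proj₁ (c ∷ cs)
    internal-node-has-all-labels {p} r b with path-or-extends-leaf pm (p ++ [ b ])
    ... | inj₁ (_ , r′) = Reach-child ct r r′
    ... | inj₂ (l , rl , z , eq) with prefixes-comparable l z p [ b ] (sym eq)
    ...   | inj₁ (m , refl) with Reach-leaf-maximal ct rl r
    ...     | ()
    internal-node-has-all-labels {p} r b | inj₂ (l , rl , z , eq) | inj₂ (x , m , refl)
      with ∷-injective (++-cancelˡ p [ b ] (x ∷ m ++ z) (trans eq (++-assoc p (x ∷ m) z)))
    ... | refl , _ = Reach-child ct r rl

    reachable-Full : ∀ {p s} → Reach t p s → Full s
    reachable-Full {s = node []}       r = inj₁ refl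
    reachable-Full {s = node (c ∷ cs)} r with Reach-IsContextTree ct r
    ... | node unique _ = inj₂ (trans (sym (length-map proj₁ (c ∷ cs)))
                                      (length-unique-allFin _ unique (internal-node-has-all-labels r)))

mainTheorem3 : ∀ (n : ℕ) (T : Tree n) → IsContextTree T → PerfectMemory T → Complete T
mainTheorem3 n T ct pm = complete-if-full T (reachable-Full ct pm)
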